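{- Let $1\le r\le t<n$ be integers. Then \[ \lambda_{n,t,r}\le\exp\!\left(-\frac{(n-t)r(r+1)}{2n(t+r+1)}\right). \]
   Context: For integers $0\le r\le m$, let $H_{m,r}:=\frac{1}{2r+1}\prod_{j=0}^{r-1}\frac{m+j+2}{m-j}$ (equivalently the squared normalized norm $\frac1{m+1}\sum_{x=0}^mQ_r^{(m)}(x)^2$ of the Hahn polynomial $Q_r^{(m)}(x)=\sum_{\ell=0}^r(-1)^\ell\binom r\ell\binom{r+\ell}\ell\frac{x^{\underline\ell}}{m^{\underline\ell}}$). For $0\le r\le t\le n$, $\lambda_{n,t,r}:=\sqrt{H_{n,r}/H_{t,r}}$. -}

module Defs where

open import Data.Nat as ℕ using (ℕ; zero; suc; _∸_)
open import Data.Integer using (+_)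
open import Data.Rational using (ℚ; _/_; _+_; _*_; _≤_; 0ℚ; 1ℚ)

-- the rational number a / b  (b ≥ 1 in all uses below; 0 if b = 0)
frac : ℕ → ℕ → ℚ
frac a zero    = 0ℚ
frac a (suc b) = + a / suc b

prodQ : ℕ → (ℕ → ℚ) → ℚ
prodQ zero    f = 1ℚ
prodQ (suc r) f = prodQ r f * f r

H : ℕ → ℕ → ℚ
H m r = frac 1 (ℕ.suc (2 ℕ.* r)) * prodQ r (λ j → frac (m ℕ.+ j ℕ.+ 2) (m ∸ j))

powQ : ℚ → ℕ → ℚ
powQ y zero    = 1ℚ
powQ y (suc k) = powQ y k * y

fact : ℕ → ℕ
fact zero    = 1
fact (suc k) = suc k ℕ.* fact k

expPartial : ℕ → ℚ → ℚ
expPartial zero    y = 1ℚ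
expPartial (suc N) y = expPartial N y + powQ y (suc N) * frac 1 (fact (suc N))

-- the exponent 2·(n-t) r (r+1) / (2 n (t+r+1)) = (n-t) r (r+1) / (n (t+r+1))
expo : ℕ → ℕ → ℕ → ℚ
expo n t r = frac ((n ∸ t) ℕ.* r ℕ.* suc r) (n ℕ.* (t ℕ.+ r ℕ.+ 1))

{-# OPTIONS --safe #-}
-- Write H m r = (2r+1)⁻¹ ∏_{j<r} u_m(j) with u_m(j) = (m+j+2)/(m−j), and split the exponent as
-- expo n t r = Σ_{j<r} d_j with d_j = (n−t)(2j+2)/(n(t+r+1)).  Since
-- (t+j+2)(n−j) = (n+j+2)(t−j) + (n−t)(2j+2), we get u_t(j) − u_n(j) = (n−t)(2j+2)/((n−j)(t−j)),
-- and (t+j+2)(n−j) ≤ n(t+r+1) then gives u_n(j) ≤ u_t(j)(1 − d_j).  Every partial sum e_N of the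
-- exponential series satisfies (1 − d) e_N(x + d) ≤ e_N(x) for x, d ≥ 0, termwise from
-- (x+d)^k − x^k ≤ k d (x+d)^(k−1); so each factor inequality absorbs one d_j, and multiplying them
-- gives ∏ u_n(j) · e_N(Σ d_j) ≤ ∏ u_t(j).
module Submission where

open import Defs
open import Data.Nat using (ℕ; _≤_; _<_)
open import Data.Rational using (_*_) renaming (_≤_ to _≤ℚ_)
open import Data.Nat as ℕ using (zero; suc; NonZero; _∸_)
import Data.Nat.Properties as ℕ
open import Data.Nat.Tactic.RingSolver using (solve-∀)
open import Data.Integer as ℤ using (+_)
import Data.Integer.Properties as ℤ
open import Data.Rational as ℚ using (ℚ; _+_; -_; 0ℚ; 1ℚ; toℚᵘ)
import Data.Rational.Properties as ℚ
open import Data.Rational.Unnormalised as ℚᵘ using (_≃_; *≤*)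
import Data.Rational.Unnormalised.Properties as ℚᵘ
open import Data.List using (_∷_; [])
open import Data.Product using (_,_)
open import Relation.Binary.PropositionalEquality
open import Relation.Nullary.Decidable.Core using (dec⇒maybe)
open import Tactic.RingSolver using (solve)
open import Tactic.RingSolver.Core.AlmostCommutativeRing using (AlmostCommutativeRing; fromCommutativeRing)

ℚ-ring : AlmostCommutativeRing _ _
ℚ-ring = fromCommutativeRing ℚ.+-*-commutativeRing (λ x → dec⇒maybe (0ℚ ℚ.≟ x))

private variable
  p q q′ : ℚ

0≤* : 0ℚ ≤ℚ p → 0ℚ ≤ℚ q → 0ℚ ≤ℚ p * q
0≤* {p} {q} 0≤p 0≤q =
  ℚ.nonNegative⁻¹ (p * q) {{ℚ.nonNeg*nonNeg⇒nonNeg p {{ℚ.nonNegative 0≤p}} q {{ℚ.nonNegative 0≤q}}}}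

*-monoˡ-≤-0≤ : 0ℚ ≤ℚ p → q ≤ℚ q′ → p * q ≤ℚ p * q′
*-monoˡ-≤-0≤ {p} 0≤p = ℚ.*-monoˡ-≤-nonNeg p {{ℚ.nonNegative 0≤p}}

*-monoʳ-≤-0≤ : 0ℚ ≤ℚ p → q ≤ℚ q′ → q * p ≤ℚ q′ * p
*-monoʳ-≤-0≤ {p} 0≤p = ℚ.*-monoʳ-≤-nonNeg p {{ℚ.nonNegative 0≤p}}

p≤p+q : 0ℚ ≤ℚ q → p ≤ℚ p + q
p≤p+q {q} {p} 0≤q = subst (_≤ℚ p + q) (ℚ.+-identityʳ p) (ℚ.+-monoʳ-≤ p 0≤q)

+-cancelʳ-≤ : ∀ r → p + r ≤ℚ q + r → p ≤ℚ q
+-cancelʳ-≤ {p} {q} r p+r≤q+r = subst₂ _≤ℚ_ (+-cancelʳ p r) (+-cancelʳ q r) (ℚ.+-monoˡ-≤ (- r) p+r≤q+r)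
  where
  +-cancelʳ : ∀ x y → x + y + - y ≡ x
  +-cancelʳ x y = solve (x ∷ y ∷ []) ℚ-ring

0≤frac : ∀ a b → 0ℚ ≤ℚ frac a b
0≤frac a zero    = ℚ.≤-refl
0≤frac a (suc b) = ℚ.nonNegative⁻¹ (frac a (suc b)) {{ℚ.normalize-nonNeg a (suc b)}}

toℚᵘ-frac : ∀ a b .{{_ : NonZero b}} → toℚᵘ (frac a b) ≃ + a ℚᵘ./ b
toℚᵘ-frac a (suc b) = ℚ.toℚᵘ-fromℚᵘ (+ a ℚᵘ./ suc b)

frac-≡ : ∀ a b c d .{{_ : NonZero b}} .{{_ : NonZero d}} → a ℕ.* d ≡ c ℕ.* b → frac a b ≡ frac c d
frac-≡ a b@(suc _) c d@(suc _) ad≡cb = ℚ.toℚᵘ-injective (begin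
  toℚᵘ (frac a b) ≈⟨ toℚᵘ-frac a b ⟩
  + a ℚᵘ./ b      ≈⟨ ℚᵘ.*≡* (trans (sym (ℤ.pos-* a d)) (trans (cong +_ ad≡cb) (ℤ.pos-* c b))) ⟩
  + c ℚᵘ./ d      ≈⟨ toℚᵘ-frac c d ⟨
  toℚᵘ (frac c d) ∎)
  where open ℚᵘ.≃-Reasoning

frac-≤ : ∀ a b c d .{{_ : NonZero b}} .{{_ : NonZero d}} → a ℕ.* d ≤ c ℕ.* b → frac a b ≤ℚ frac c d
frac-≤ a b@(suc _) c d@(suc _) ad≤cb = ℚ.toℚᵘ-cancel-≤ (begin
  toℚᵘ (frac a b) ≃⟨ toℚᵘ-frac a b ⟩
  + a ℚᵘ./ b      ≤⟨ *≤* (subst₂ ℤ._≤_ (ℤ.pos-* a d) (ℤ.pos-* c b) (ℤ.+≤+ ad≤cb)) ⟩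
  + c ℚᵘ./ d      ≃⟨ toℚᵘ-frac c d ⟨
  toℚᵘ (frac c d) ∎)
  where open ℚᵘ.≤-Reasoning

frac-+ : ∀ a b c d .{{_ : NonZero b}} .{{_ : NonZero d}} →
         frac a b + frac c d ≡ frac (a ℕ.* d ℕ.+ c ℕ.* b) (b ℕ.* d)
frac-+ a b@(suc _) c d@(suc _) = ℚ.toℚᵘ-injective (begin
  toℚᵘ (frac a b + frac c d)                  ≈⟨ ℚ.toℚᵘ-homo-+ (frac a b) (frac c d) ⟩
  toℚᵘ (frac a b) ℚᵘ.+ toℚᵘ (frac c d)        ≈⟨ ℚᵘ.+-cong (toℚᵘ-frac a b) (toℚᵘ-frac c d) ⟩
  (+ a ℚᵘ./ b) ℚᵘ.+ (+ c ℚᵘ./ d)              ≡⟨ ℚᵘ./-cong numerator refl ⟩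
  + (a ℕ.* d ℕ.+ c ℕ.* b) ℚᵘ./ (b ℕ.* d)      ≈⟨ toℚᵘ-frac (a ℕ.* d ℕ.+ c ℕ.* b) (b ℕ.* d) ⟨
  toℚᵘ (frac (a ℕ.* d ℕ.+ c ℕ.* b) (b ℕ.* d)) ∎)
  where
  open ℚᵘ.≃-Reasoning
  numerator : + a ℤ.* + d ℤ.+ + c ℤ.* + b ≡ + (a ℕ.* d ℕ.+ c ℕ.* b)
  numerator = trans (cong₂ ℤ._+_ (sym (ℤ.pos-* a d)) (sym (ℤ.pos-* c b))) (sym (ℤ.pos-+ (a ℕ.* d) (c ℕ.* b)))

frac-* : ∀ a b c d .{{_ : NonZero b}} .{{_ : NonZero d}} →
         frac a b * frac c d ≡ frac (a ℕ.* c) (b ℕ.* d)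
frac-* a b@(suc _) c d@(suc _) = ℚ.toℚᵘ-injective (begin
  toℚᵘ (frac a b * frac c d)                  ≈⟨ ℚ.toℚᵘ-homo-* (frac a b) (frac c d) ⟩
  toℚᵘ (frac a b) ℚᵘ.* toℚᵘ (frac c d)        ≈⟨ ℚᵘ.*-cong (toℚᵘ-frac a b) (toℚᵘ-frac c d) ⟩
  (+ a ℚᵘ./ b) ℚᵘ.* (+ c ℚᵘ./ d)              ≡⟨ ℚᵘ./-cong (sym (ℤ.pos-* a c)) refl ⟩
  + (a ℕ.* c) ℚᵘ./ (b ℕ.* d)                  ≈⟨ toℚᵘ-frac (a ℕ.* c) (b ℕ.* d) ⟨
  toℚᵘ (frac (a ℕ.* c) (b ℕ.* d))             ∎)
  where open ℚᵘ.≃-Reasoning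

frac-0 : ∀ b .{{_ : NonZero b}} → frac 0 b ≡ 0ℚ
frac-0 b@(suc _) = ℚ.0/n≡0 b

frac-+-sameDenom : ∀ a c b .{{_ : NonZero b}} → frac a b + frac c b ≡ frac (a ℕ.+ c) b
frac-+-sameDenom a c b@(suc _) =
  trans (frac-+ a b c b) (frac-≡ (a ℕ.* b ℕ.+ c ℕ.* b) (b ℕ.* b) (a ℕ.+ c) b (eq a b c))
  where
  eq : ∀ a b c → (a ℕ.* b ℕ.+ c ℕ.* b) ℕ.* b ≡ (a ℕ.+ c) ℕ.* (b ℕ.* b)
  eq = solve-∀

frac-suc : ∀ k → frac (suc k) 1 ≡ 1ℚ + frac k 1
frac-suc k = sym (trans (frac-+ 1 1 k 1) (cong (λ a → frac (suc a) 1) (ℕ.*-identityʳ k)))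

frac-cancelˡ : ∀ k f .{{_ : NonZero k}} .{{_ : NonZero f}} → frac k 1 * frac 1 (k ℕ.* f) ≡ frac 1 f
frac-cancelˡ k@(suc _) f@(suc _) =
  trans (frac-* k 1 1 (k ℕ.* f)) (frac-≡ (k ℕ.* 1) (1 ℕ.* (k ℕ.* f)) 1 f (eq k f))
  where
  eq : ∀ k f → k ℕ.* 1 ℕ.* f ≡ 1 ℕ.* (1 ℕ.* (k ℕ.* f))
  eq = solve-∀

fact-nonZero : ∀ m → NonZero (fact m)
fact-nonZero zero    = _
fact-nonZero (suc m) = ℕ.m*n≢0 (suc m) (fact m) {{_}} {{fact-nonZero m}}

powQ-nonNeg : 0ℚ ≤ℚ p → ∀ k → 0ℚ ≤ℚ powQ p k
powQ-nonNeg 0≤p zero    = 0≤frac 1 1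
powQ-nonNeg 0≤p (suc k) = 0≤* (powQ-nonNeg 0≤p k) 0≤p

powQ-mono-≤ : 0ℚ ≤ℚ p → p ≤ℚ q → ∀ k → powQ p k ≤ℚ powQ q k
powQ-mono-≤ 0≤p p≤q zero    = ℚ.≤-refl
powQ-mono-≤ 0≤p p≤q (suc k) = ℚ.≤-trans (*-monoʳ-≤-0≤ 0≤p (powQ-mono-≤ 0≤p p≤q k))
                                        (*-monoˡ-≤-0≤ (powQ-nonNeg (ℚ.≤-trans 0≤p p≤q) k) p≤q)

powQ-+-≤ : 0ℚ ≤ℚ p → 0ℚ ≤ℚ q → ∀ k →
           powQ (p + q) (suc k) ≤ℚ powQ p (suc k) + frac (suc k) 1 * q * powQ (p + q) k
powQ-+-≤ {p} {q} 0≤p 0≤q zero    = ℚ.≤-reflexive (eq p q)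
  where
  eq : ∀ p q → 1ℚ * (p + q) ≡ 1ℚ * p + 1ℚ * q * 1ℚ
  eq p q = solve (p ∷ q ∷ []) ℚ-ring
powQ-+-≤ {p} {q} 0≤p 0≤q (suc k) = begin
  powQ (p + q) (suc k) * (p + q)
    ≤⟨ *-monoʳ-≤-0≤ (ℚ.+-mono-≤ 0≤p 0≤q) (powQ-+-≤ 0≤p 0≤q k) ⟩
  (a + c * q * s) * (p + q)
    ≡⟨ expand a c q s p ⟩
  a * p + a * q + c * q * (s * (p + q))
    ≤⟨ ℚ.+-monoˡ-≤ (c * q * (s * (p + q))) (ℚ.+-monoʳ-≤ (a * p)
         (*-monoʳ-≤-0≤ 0≤q (powQ-mono-≤ 0≤p (p≤p+q 0≤q) (suc k)))) ⟩
  a * p + s * (p + q) * q + c * q * (s * (p + q))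
    ≡⟨ collect a p s q c ⟩
  a * p + (1ℚ + c) * q * (s * (p + q))
    ≡⟨ cong (λ c′ → a * p + c′ * q * (s * (p + q))) (frac-suc (suc k)) ⟨
  powQ p (suc (suc k)) + frac (suc (suc k)) 1 * q * powQ (p + q) (suc k) ∎
  where
  open ℚ.≤-Reasoning
  a = powQ p (suc k)
  c = frac (suc k) 1
  s = powQ (p + q) k
  expand : ∀ a c q s p → (a + c * q * s) * (p + q) ≡ a * p + a * q + c * q * (s * (p + q))
  expand a c q s p = solve (a ∷ c ∷ q ∷ s ∷ p ∷ []) ℚ-ring
  collect : ∀ a p s q c →
    a * p + s * (p + q) * q + c * q * (s * (p + q)) ≡ a * p + (1ℚ + c) * q * (s * (p + q))
  collect a p s q c = solve (a ∷ p ∷ s ∷ q ∷ c ∷ []) ℚ-ring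

expPartial-nonNeg : 0ℚ ≤ℚ p → ∀ N → 0ℚ ≤ℚ expPartial N p
expPartial-nonNeg 0≤p zero    = 0≤frac 1 1
expPartial-nonNeg 0≤p (suc N) =
  ℚ.+-mono-≤ (expPartial-nonNeg 0≤p N) (0≤* (powQ-nonNeg 0≤p (suc N)) (0≤frac 1 (fact (suc N))))

expPartial-≤-suc : 0ℚ ≤ℚ p → ∀ N → expPartial N p ≤ℚ expPartial (suc N) p
expPartial-≤-suc 0≤p N = p≤p+q (0≤* (powQ-nonNeg 0≤p (suc N)) (0≤frac 1 (fact (suc N))))

expPartial-0 : ∀ N → expPartial N 0ℚ ≡ 1ℚ
expPartial-0 zero    = refl
expPartial-0 (suc N) = trans (eq (expPartial N 0ℚ) (powQ 0ℚ N) (frac 1 (fact (suc N)))) (expPartial-0 N)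
  where
  eq : ∀ e z f → e + z * 0ℚ * f ≡ e
  eq e z f = solve (e ∷ z ∷ f ∷ []) ℚ-ring

expTerm-+-≤ : 0ℚ ≤ℚ p → 0ℚ ≤ℚ q → ∀ k →
  powQ (p + q) (suc k) * frac 1 (fact (suc k)) ≤ℚ
  powQ p (suc k) * frac 1 (fact (suc k)) + q * (powQ (p + q) k * frac 1 (fact k))
expTerm-+-≤ {p} {q} 0≤p 0≤q k = begin
  powQ (p + q) (suc k) * f
    ≤⟨ *-monoʳ-≤-0≤ (0≤frac 1 (fact (suc k))) (powQ-+-≤ 0≤p 0≤q k) ⟩
  (powQ p (suc k) + c * q * s) * f
    ≡⟨ regroup (powQ p (suc k)) c q s f ⟩
  powQ p (suc k) * f + q * (s * (c * f))
    ≡⟨ cong (λ x → powQ p (suc k) * f + q * (s * x)) (frac-cancelˡ (suc k) (fact k) {{_}} {{fact-nonZero k}}) ⟩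
  powQ p (suc k) * f + q * (s * frac 1 (fact k)) ∎
  where
  open ℚ.≤-Reasoning
  f = frac 1 (fact (suc k))
  c = frac (suc k) 1
  s = powQ (p + q) k
  regroup : ∀ a c q s f → (a + c * q * s) * f ≡ a * f + q * (s * (c * f))
  regroup a c q s f = solve (a ∷ c ∷ q ∷ s ∷ f ∷ []) ℚ-ring

expPartial-suc-+-≤ : 0ℚ ≤ℚ p → 0ℚ ≤ℚ q → ∀ N →
  expPartial (suc N) (p + q) ≤ℚ expPartial (suc N) p + q * expPartial N (p + q)
expPartial-suc-+-≤ {p} {q} 0≤p 0≤q zero = begin
  1ℚ + powQ (p + q) 1 * 1ℚ                  ≤⟨ ℚ.+-monoʳ-≤ 1ℚ (expTerm-+-≤ 0≤p 0≤q 0) ⟩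
  1ℚ + (powQ p 1 * 1ℚ + q * (1ℚ * 1ℚ))      ≡⟨ regroup (powQ p 1 * 1ℚ) q ⟩
  1ℚ + powQ p 1 * 1ℚ + q * 1ℚ               ∎
  where
  open ℚ.≤-Reasoning
  regroup : ∀ a q → 1ℚ + (a + q * (1ℚ * 1ℚ)) ≡ 1ℚ + a + q * 1ℚ
  regroup a q = solve (a ∷ q ∷ []) ℚ-ring
expPartial-suc-+-≤ {p} {q} 0≤p 0≤q (suc N) = begin
  expPartial (suc N) (p + q) + powQ (p + q) (2 ℕ.+ N) * frac 1 (fact (2 ℕ.+ N))
    ≤⟨ ℚ.+-mono-≤ (expPartial-suc-+-≤ 0≤p 0≤q N) (expTerm-+-≤ 0≤p 0≤q (suc N)) ⟩
  (expPartial (suc N) p + q * expPartial N (p + q)) +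
  (powQ p (2 ℕ.+ N) * frac 1 (fact (2 ℕ.+ N)) + q * (powQ (p + q) (suc N) * frac 1 (fact (suc N))))
    ≡⟨ regroup (expPartial (suc N) p) q (expPartial N (p + q))
               (powQ p (2 ℕ.+ N) * frac 1 (fact (2 ℕ.+ N))) (powQ (p + q) (suc N) * frac 1 (fact (suc N))) ⟩
  expPartial (2 ℕ.+ N) p + q * expPartial (suc N) (p + q) ∎
  where
  open ℚ.≤-Reasoning
  regroup : ∀ a q b c d → (a + q * b) + (c + q * d) ≡ (a + c) + q * (b + d)
  regroup a q b c d = solve (a ∷ q ∷ b ∷ c ∷ d ∷ []) ℚ-ring

-- (1 − q) e_N(p + q) ≤ e_N(p), a truncated form of e^(−q) ≥ 1 − q.
expPartial-+-≤ : 0ℚ ≤ℚ p → 0ℚ ≤ℚ q → ∀ N →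
  expPartial N (p + q) ≤ℚ expPartial N p + q * expPartial N (p + q)
expPartial-+-≤ 0≤p 0≤q zero    = p≤p+q (0≤* 0≤q (0≤frac 1 1))
expPartial-+-≤ 0≤p 0≤q (suc N) = ℚ.≤-trans (expPartial-suc-+-≤ 0≤p 0≤q N)
  (ℚ.+-monoʳ-≤ (expPartial (suc N) _) (*-monoˡ-≤-0≤ 0≤q (expPartial-≤-suc (ℚ.+-mono-≤ 0≤p 0≤q) N)))

*-expPartial-+-≤ : ∀ {u v d} → 0ℚ ≤ℚ v → 0ℚ ≤ℚ p → 0ℚ ≤ℚ d → u + v * d ≤ℚ v → ∀ N →
  u * expPartial N (p + d) ≤ℚ v * expPartial N p
*-expPartial-+-≤ {p} {u} {v} {d} 0≤v 0≤p 0≤d u+vd≤v N = +-cancelʳ-≤ (v * d * e′) (begin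
  u * e′ + v * d * e′   ≡⟨ distribʳ u (v * d) e′ ⟨
  (u + v * d) * e′      ≤⟨ *-monoʳ-≤-0≤ (expPartial-nonNeg (ℚ.+-mono-≤ 0≤p 0≤d) N) u+vd≤v ⟩
  v * e′                ≤⟨ *-monoˡ-≤-0≤ 0≤v (expPartial-+-≤ 0≤p 0≤d N) ⟩
  v * (e + d * e′)      ≡⟨ distribˡ v e d e′ ⟩
  v * e + v * d * e′    ∎)
  where
  open ℚ.≤-Reasoning
  e = expPartial N p
  e′ = expPartial N (p + d)
  distribʳ : ∀ x y z → (x + y) * z ≡ x * z + y * z
  distribʳ x y z = solve (x ∷ y ∷ z ∷ []) ℚ-ring
  distribˡ : ∀ x y z w → x * (y + z * w) ≡ x * y + x * z * w
  distribˡ x y z w = solve (x ∷ y ∷ z ∷ w ∷ []) ℚ-ring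

sumQ : ℕ → (ℕ → ℚ) → ℚ
sumQ zero    f = 0ℚ
sumQ (suc r) f = sumQ r f + f r

sumQ-nonNeg : ∀ {f} → (∀ j → 0ℚ ≤ℚ f j) → ∀ r → 0ℚ ≤ℚ sumQ r f
sumQ-nonNeg 0≤f zero    = ℚ.≤-refl
sumQ-nonNeg 0≤f (suc r) = ℚ.+-mono-≤ (sumQ-nonNeg 0≤f r) (0≤f r)

prodQ-nonNeg : ∀ {f} → (∀ j → 0ℚ ≤ℚ f j) → ∀ r → 0ℚ ≤ℚ prodQ r f
prodQ-nonNeg 0≤f zero    = 0≤frac 1 1
prodQ-nonNeg 0≤f (suc r) = 0≤* (prodQ-nonNeg 0≤f r) (0≤f r)

prodQ-*-expPartial-sumQ-≤ : ∀ {u v d} →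
  (∀ j → 0ℚ ≤ℚ u j) → (∀ j → 0ℚ ≤ℚ v j) → (∀ j → 0ℚ ≤ℚ d j) →
  ∀ r → (∀ j → j < r → u j + v j * d j ≤ℚ v j) → ∀ N →
  prodQ r u * expPartial N (sumQ r d) ≤ℚ prodQ r v
prodQ-*-expPartial-sumQ-≤ 0≤u 0≤v 0≤d zero    _ N = ℚ.≤-reflexive (trans (ℚ.*-identityˡ _) (expPartial-0 N))
prodQ-*-expPartial-sumQ-≤ {u} {v} {d} 0≤u 0≤v 0≤d (suc r) factor-≤ N = begin
  U * u r * expPartial N (x + d r)    ≡⟨ ℚ.*-assoc U (u r) (expPartial N (x + d r)) ⟩
  U * (u r * expPartial N (x + d r))  ≤⟨ *-monoˡ-≤-0≤ (prodQ-nonNeg 0≤u r)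
                                           (*-expPartial-+-≤ {u = u r} (0≤v r) (sumQ-nonNeg 0≤d r) (0≤d r)
                                                             (factor-≤ r ℕ.≤-refl) N) ⟩
  U * (v r * expPartial N x)          ≡⟨ swap U (v r) (expPartial N x) ⟩
  U * expPartial N x * v r            ≤⟨ *-monoʳ-≤-0≤ (0≤v r) (prodQ-*-expPartial-sumQ-≤ 0≤u 0≤v 0≤d r
                                           (λ j j<r → factor-≤ j (ℕ.m<n⇒m<1+n j<r)) N) ⟩
  prodQ r v * v r                     ∎
  where
  open ℚ.≤-Reasoning
  U = prodQ r u
  x = sumQ r d
  swap : ∀ a b c → a * (b * c) ≡ a * c * b
  swap a b c = solve (a ∷ b ∷ c ∷ []) ℚ-ring

sumQ-arithmetic : ∀ E D .{{_ : NonZero D}} r →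
  sumQ r (λ j → frac (E ℕ.* (2 ℕ.* j ℕ.+ 2)) D) ≡ frac (E ℕ.* r ℕ.* suc r) D
sumQ-arithmetic E D zero    =
  trans (sym (frac-0 D)) (cong (λ a → frac a D) (sym (trans (ℕ.*-identityʳ (E ℕ.* 0)) (ℕ.*-zeroʳ E))))
sumQ-arithmetic E D (suc r) = begin
  sumQ r (λ j → frac (E ℕ.* (2 ℕ.* j ℕ.+ 2)) D) + frac (E ℕ.* (2 ℕ.* r ℕ.+ 2)) D
    ≡⟨ cong (_+ frac (E ℕ.* (2 ℕ.* r ℕ.+ 2)) D) (sumQ-arithmetic E D r) ⟩
  frac (E ℕ.* r ℕ.* suc r) D + frac (E ℕ.* (2 ℕ.* r ℕ.+ 2)) D
    ≡⟨ frac-+-sameDenom (E ℕ.* r ℕ.* suc r) (E ℕ.* (2 ℕ.* r ℕ.+ 2)) D ⟩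
  frac (E ℕ.* r ℕ.* suc r ℕ.+ E ℕ.* (2 ℕ.* r ℕ.+ 2)) D
    ≡⟨ cong (λ a → frac a D) (step E r) ⟩
  frac (E ℕ.* suc r ℕ.* suc (suc r)) D ∎
  where
  open ≡-Reasoning
  step : ∀ E r → E ℕ.* r ℕ.* suc r ℕ.+ E ℕ.* (2 ℕ.* r ℕ.+ 2) ≡ E ℕ.* suc r ℕ.* suc (suc r)
  step = solve-∀

cross-multiplied-≤ : ∀ A a B b F D → B ℕ.* a ≡ A ℕ.* b ℕ.+ F → B ℕ.* a ≤ D →
  (A ℕ.* (b ℕ.* D) ℕ.+ B ℕ.* F ℕ.* a) ℕ.* b ≤ B ℕ.* (a ℕ.* (b ℕ.* D))
cross-multiplied-≤ A a B b F D Ba≡Ab+F Ba≤D = begin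
  (A ℕ.* (b ℕ.* D) ℕ.+ B ℕ.* F ℕ.* a) ℕ.* b     ≡⟨ expand A a B b F D ⟩
  A ℕ.* b ℕ.* b ℕ.* D ℕ.+ F ℕ.* b ℕ.* (B ℕ.* a)
    ≤⟨ ℕ.+-monoʳ-≤ (A ℕ.* b ℕ.* b ℕ.* D) (ℕ.*-monoʳ-≤ (F ℕ.* b) Ba≤D) ⟩
  A ℕ.* b ℕ.* b ℕ.* D ℕ.+ F ℕ.* b ℕ.* D         ≡⟨ factor A b F D ⟩
  (A ℕ.* b ℕ.+ F) ℕ.* b ℕ.* D                   ≡⟨ cong (λ x → x ℕ.* b ℕ.* D) Ba≡Ab+F ⟨
  B ℕ.* a ℕ.* b ℕ.* D                           ≡⟨ reassoc B a b D ⟩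
  B ℕ.* (a ℕ.* (b ℕ.* D))                       ∎
  where
  open ℕ.≤-Reasoning
  expand : ∀ A a B b F D →
    (A ℕ.* (b ℕ.* D) ℕ.+ B ℕ.* F ℕ.* a) ℕ.* b ≡ A ℕ.* b ℕ.* b ℕ.* D ℕ.+ F ℕ.* b ℕ.* (B ℕ.* a)
  expand = solve-∀
  factor : ∀ A b F D → A ℕ.* b ℕ.* b ℕ.* D ℕ.+ F ℕ.* b ℕ.* D ≡ (A ℕ.* b ℕ.+ F) ℕ.* b ℕ.* D
  factor = solve-∀
  reassoc : ∀ B a b D → B ℕ.* a ℕ.* b ℕ.* D ≡ B ℕ.* (a ℕ.* (b ℕ.* D))
  reassoc = solve-∀

-- B/b − A/a = F/(ab), and (B/b)(F/D) = (F/(ab))(Ba/D) ≤ F/(ab).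
frac-+-*-≤ : ∀ A a B b F D .{{_ : NonZero a}} .{{_ : NonZero b}} .{{_ : NonZero D}} →
  B ℕ.* a ≡ A ℕ.* b ℕ.+ F → B ℕ.* a ≤ D → frac A a + frac B b * frac F D ≤ℚ frac B b
frac-+-*-≤ A a@(suc _) B b@(suc _) F D@(suc _) Ba≡Ab+F Ba≤D = begin
  frac A a + frac B b * frac F D                              ≡⟨ cong (λ x → frac A a + x) (frac-* B b F D) ⟩
  frac A a + frac (B ℕ.* F) (b ℕ.* D)                         ≡⟨ frac-+ A a (B ℕ.* F) (b ℕ.* D) ⟩
  frac (A ℕ.* (b ℕ.* D) ℕ.+ B ℕ.* F ℕ.* a) (a ℕ.* (b ℕ.* D))
    ≤⟨ frac-≤ (A ℕ.* (b ℕ.* D) ℕ.+ B ℕ.* F ℕ.* a) (a ℕ.* (b ℕ.* D)) B b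
              (cross-multiplied-≤ A a B b F D Ba≡Ab+F Ba≤D) ⟩
  frac B b                                                    ∎
  where open ℚ.≤-Reasoning

hahnFactor : ℕ → ℕ → ℚ
hahnFactor m j = frac (m ℕ.+ j ℕ.+ 2) (m ∸ j)

expoTerm : ℕ → ℕ → ℕ → ℕ → ℚ
expoTerm n t r j = frac ((n ∸ t) ℕ.* (2 ℕ.* j ℕ.+ 2)) (n ℕ.* (t ℕ.+ r ℕ.+ 1))

0≤hahnFactor : ∀ m j → 0ℚ ≤ℚ hahnFactor m j
0≤hahnFactor m j = 0≤frac (m ℕ.+ j ℕ.+ 2) (m ∸ j)

0≤expoTerm : ∀ n t r j → 0ℚ ≤ℚ expoTerm n t r j
0≤expoTerm n t r j = 0≤frac ((n ∸ t) ℕ.* (2 ℕ.* j ℕ.+ 2)) (n ℕ.* (t ℕ.+ r ℕ.+ 1))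

expoDenominator-nonZero : ∀ {t n} r → t < n → NonZero (n ℕ.* (t ℕ.+ r ℕ.+ 1))
expoDenominator-nonZero {t} {n} r t<n =
  ℕ.m*n≢0 n (t ℕ.+ r ℕ.+ 1)
    {{ℕ.>-nonZero (ℕ.≤-<-trans ℕ.z≤n t<n)}} {{ℕ.>-nonZero (ℕ.m≤n+m 1 (t ℕ.+ r))}}

expo≡sumQ-expoTerm : ∀ {t n} r → t < n → expo n t r ≡ sumQ r (expoTerm n t r)
expo≡sumQ-expoTerm {t} {n} r t<n =
  sym (sumQ-arithmetic (n ∸ t) (n ℕ.* (t ℕ.+ r ℕ.+ 1)) {{expoDenominator-nonZero r t<n}} r)

hahnFactor-gap : ∀ {j t n} → j ≤ t → t ≤ n →
  (t ℕ.+ j ℕ.+ 2) ℕ.* (n ∸ j) ≡ (n ℕ.+ j ℕ.+ 2) ℕ.* (t ∸ j) ℕ.+ (n ∸ t) ℕ.* (2 ℕ.* j ℕ.+ 2)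
hahnFactor-gap {j} j≤t t≤n with ℕ.m≤n⇒∃[o]m+o≡n j≤t | ℕ.m≤n⇒∃[o]m+o≡n t≤n
... | b , refl | e , refl
  rewrite ℕ.m+n∸m≡n j b | ℕ.m+n∸m≡n (j ℕ.+ b) e | ℕ.+-assoc j b e | ℕ.m+n∸m≡n j (b ℕ.+ e)
  = identity j b e
  where
  identity : ∀ j b e →
    (j ℕ.+ b ℕ.+ j ℕ.+ 2) ℕ.* (b ℕ.+ e) ≡
    (j ℕ.+ (b ℕ.+ e) ℕ.+ j ℕ.+ 2) ℕ.* b ℕ.+ e ℕ.* (2 ℕ.* j ℕ.+ 2)
  identity = solve-∀

hahnFactor-bound : ∀ {j r t} n → j < r → (t ℕ.+ j ℕ.+ 2) ℕ.* (n ∸ j) ≤ n ℕ.* (t ℕ.+ r ℕ.+ 1)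
hahnFactor-bound {j} {r} {t} n j<r = begin
  (t ℕ.+ j ℕ.+ 2) ℕ.* (n ∸ j)   ≤⟨ ℕ.*-mono-≤ t+j+2≤t+r+1 (ℕ.m∸n≤m n j) ⟩
  (t ℕ.+ r ℕ.+ 1) ℕ.* n         ≡⟨ ℕ.*-comm (t ℕ.+ r ℕ.+ 1) n ⟩
  n ℕ.* (t ℕ.+ r ℕ.+ 1)         ∎
  where
  open ℕ.≤-Reasoning
  shift : ∀ t j → t ℕ.+ suc j ℕ.+ 1 ≡ t ℕ.+ j ℕ.+ 2
  shift = solve-∀
  t+j+2≤t+r+1 : t ℕ.+ j ℕ.+ 2 ≤ t ℕ.+ r ℕ.+ 1
  t+j+2≤t+r+1 = subst (_≤ t ℕ.+ r ℕ.+ 1) (shift t j) (ℕ.+-monoˡ-≤ 1 (ℕ.+-monoʳ-≤ t j<r))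

hahnFactor-+-*-≤ : ∀ {j r t n} → j < r → r ≤ t → t < n →
  hahnFactor n j + hahnFactor t j * expoTerm n t r j ≤ℚ hahnFactor t j
hahnFactor-+-*-≤ {j} {r} {t} {n} j<r r≤t t<n =
  frac-+-*-≤ (n ℕ.+ j ℕ.+ 2) (n ∸ j) (t ℕ.+ j ℕ.+ 2) (t ∸ j)
             ((n ∸ t) ℕ.* (2 ℕ.* j ℕ.+ 2)) (n ℕ.* (t ℕ.+ r ℕ.+ 1))
             {{ℕ.>-nonZero (ℕ.m<n⇒0<n∸m j<n)}} {{ℕ.>-nonZero (ℕ.m<n⇒0<n∸m j<t)}}
             {{expoDenominator-nonZero r t<n}}
             (hahnFactor-gap (ℕ.<⇒≤ j<t) (ℕ.<⇒≤ t<n)) (hahnFactor-bound n j<r)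
  where
  j<t = ℕ.<-≤-trans j<r r≤t
  j<n = ℕ.<-trans j<t t<n

lemma5 : (n t r : ℕ) → 1 ≤ r → r ≤ t → t < n →
    (N : ℕ) → H n r * expPartial N (expo n t r) ≤ℚ H t r
lemma5 n t r _ r≤t t<n N = begin
  c * prodQ r (hahnFactor n) * expPartial N (expo n t r)
    ≡⟨ cong (λ x → c * prodQ r (hahnFactor n) * expPartial N x) (expo≡sumQ-expoTerm r t<n) ⟩
  c * prodQ r (hahnFactor n) * expPartial N (sumQ r (expoTerm n t r))
    ≡⟨ ℚ.*-assoc c (prodQ r (hahnFactor n)) (expPartial N (sumQ r (expoTerm n t r))) ⟩
  c * (prodQ r (hahnFactor n) * expPartial N (sumQ r (expoTerm n t r)))
    ≤⟨ *-monoˡ-≤-0≤ (0≤frac 1 (suc (2 ℕ.* r)))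
         (prodQ-*-expPartial-sumQ-≤ (0≤hahnFactor n) (0≤hahnFactor t) (0≤expoTerm n t r) r
           (λ j j<r → hahnFactor-+-*-≤ j<r r≤t t<n) N) ⟩
  c * prodQ r (hahnFactor t) ∎
  where
  open ℚ.≤-Reasoning
  c = frac 1 (suc (2 ℕ.* r))
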